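{- Let $n \ge 1$ and let $u$ be a vertex of $ST_3^n$ that is not an extreme vertex. Then there exist vertices $v, w$ of $ST_3^n$ such that $I(v,w) \setminus \{v,w\} = \{u\}$, i.e., $u$ is the only internal vertex of any shortest $v,w$-path.
   Context: Sierpiński triangle graphs are defined recursively: $ST_3^0 = K_3$, whose three vertices are its extreme vertices, called top, left and right. For $n \ge 0$, $ST_3^{n+1}$ is obtained from three disjoint copies $T, L, R$ of $ST_3^n$ by identifying the left extreme vertex of $T$ with the top extreme vertex of $L$, the right extreme vertex of $T$ with the top extreme vertex of $R$, and the right extreme vertex of $L$ with the left extreme vertex of $R$; the extreme vertices of $ST_3^{n+1}$ are the top vertex of $T$, the left vertex of $L$ and the right vertex of $R$. The interval $I(v,w)$ is the set of vertices lying on shortest $v,w$-paths (including $v$ and $w$). -}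

module Defs where

open import Data.Nat using (ℕ; zero; suc; _≤_)
open import Data.Product using (_×_; _,_; ∃; ∃-syntax)
open import Data.Sum using (_⊎_)
open import Relation.Binary.PropositionalEquality using (_≡_; _≢_)
open import Relation.Binary.Construct.Closure.Equivalence using (EqClosure)

-- The three extreme positions / the three copies T, L, R.
data Pos : Set where
  top left right : Pos

-- Raw vertices of ST_3^n, before identification:
-- ST_3^0 = K_3 has vertices top, left, right;
-- a raw vertex of ST_3^(n+1) is a copy (T, L or R) together with a raw vertex of that copy.
V : ℕ → Set
V zero    = Pos
V (suc n) = Pos × V n

ext : (n : ℕ) → Pos → V n
ext zero    e = e
ext (suc n) e = e , ext n e

data Glue : (n : ℕ) → V n → V n → Set where
  inside   : ∀ {n} c {x y : V n} → Glue n x y → Glue (suc n) (c , x) (c , y)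
  glueTL   : ∀ {n} → Glue (suc n) (top , ext n left) (left , ext n top)
  glueTR   : ∀ {n} → Glue (suc n) (top , ext n right) (right , ext n top)
  glueLR   : ∀ {n} → Glue (suc n) (left , ext n right) (right , ext n left)

Same : (n : ℕ) → V n → V n → Set
Same n = EqClosure (Glue n)

data RawEdge : (n : ℕ) → V n → V n → Set where
  k3   : {x y : Pos} → x ≢ y → RawEdge zero x y
  copy : ∀ {n} c {x y : V n} → RawEdge n x y → RawEdge (suc n) (c , x) (c , y)

Adj : (n : ℕ) → V n → V n → Set
Adj n x y = ∃[ x' ] ∃[ y' ] (Same n x x' × RawEdge n x' y' × Same n y' y)

data Walk (n : ℕ) : V n → V n → Set where
  stop : ∀ {x y} → Same n x y → Walk n x y
  step : ∀ {x y z} → Adj n x y → Walk n y z → Walk n x z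

length : ∀ {n x y} → Walk n x y → ℕ
length (stop _)   = 0
length (step _ p) = suc (length p)

data OnWalk (n : ℕ) (u : V n) : ∀ {x y} → Walk n x y → Set where
  here  : ∀ {x y} {p : Walk n x y} → Same n u x → OnWalk n u p
  there : ∀ {x y z} {a : Adj n x y} {p : Walk n y z} → OnWalk n u p → OnWalk n u (step a p)

IsShortest : ∀ {n v w} → Walk n v w → Set
IsShortest {n} {v} {w} p = (q : Walk n v w) → length p ≤ length q

InInterval : (n : ℕ) → V n → V n → V n → Set
InInterval n v w u = ∃[ p ] (IsShortest {n} {v} {w} p × OnWalk n u p)

IsExtreme : (n : ℕ) → V n → Set
IsExtreme n u = ∃[ e ] Same n u (ext n e)

{-# OPTIONS --safe #-}
-- Place ST_3^n in the triangular lattice ℕ²: copy T sits at the origin and the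
-- copies L and R are shifted by the side length 2^n along the two axes.  This
-- position map is injective on vertices and sends edges to unit lattice steps.
-- Every non-extreme vertex u is the midpoint of a straight lattice segment of
-- length 2 between two of its neighbours v and w: either u has this property
-- inside its copy already, or u is one of the three junctions of the copies,
-- where the segment crosses from one copy into the other.  As v and w are
-- neither equal nor lattice-adjacent, d(v,w) = 2, and the inner vertex of a
-- shortest v,w-path is a common lattice neighbour of the ends of the segment,
-- which can only be its midpoint u.
module Submission where

open import Defs
open import Data.Nat using (ℕ; zero; suc; _+_; _≤_; z≤n; s≤s)
open import Data.Nat.Properties
  using (+-assoc; +-identityʳ; +-commutativeSemigroup; +-cancelʳ-≤; +-cancelʳ-≡; m≤m+n; +-monoˡ-≤;
         ≤-trans; ≤-reflexive; n≤0⇒n≡0; m+n≡0⇒m≡0; m+n≡0⇒n≡0)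
open import Algebra.Properties.CommutativeSemigroup +-commutativeSemigroup using (xy∙z≈xz∙y)
open import Data.Product using (_×_; ∃-syntax; _,_)
open import Data.Sum using (_⊎_; inj₁; inj₂)
open import Function.Bundles using (_⇔_; mk⇔)
open import Relation.Nullary using (¬_; yes; no; contradiction)
open import Relation.Binary.Definitions using (DecidableEquality)
open import Relation.Binary.PropositionalEquality
open import Relation.Binary.Construct.Closure.Equivalence as EqClosure using ()
open import Relation.Binary.Construct.Closure.ReflexiveTransitive using (ε; _◅_; _◅◅_)
open import Relation.Binary.Construct.Closure.Symmetric using (fwd; bwd)

_≟_ : DecidableEquality Pos
top   ≟ top   = yes refl
top   ≟ left  = no λ ()
top   ≟ right = no λ ()
left  ≟ top   = no λ ()
left  ≟ left  = yes refl
left  ≟ right = no λ ()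
right ≟ top   = no λ ()
right ≟ left  = no λ ()
right ≟ right = yes refl

-- The triangular lattice

data Point : Set where
  pt : ℕ → ℕ → Point

sum : Point → ℕ
sum (pt a b) = a + b

data LatticeAdj : Point → Point → Set where
  inc₁   : ∀ {a b} → LatticeAdj (pt a b) (pt (suc a) b)
  dec₁   : ∀ {a b} → LatticeAdj (pt (suc a) b) (pt a b)
  inc₂   : ∀ {a b} → LatticeAdj (pt a b) (pt a (suc b))
  dec₂   : ∀ {a b} → LatticeAdj (pt a (suc b)) (pt a b)
  move₁₂ : ∀ {a b} → LatticeAdj (pt (suc a) b) (pt a (suc b))
  move₂₁ : ∀ {a b} → LatticeAdj (pt a (suc b)) (pt (suc a) b)

data Straight : Point → Point → Point → Set where
  along₁  : ∀ {a b} → Straight (pt a b) (pt (suc a) b) (pt (suc (suc a)) b)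
  along₂  : ∀ {a b} → Straight (pt a b) (pt a (suc b)) (pt a (suc (suc b)))
  along₁₂ : ∀ {a b} → Straight (pt a (suc (suc b))) (pt (suc a) (suc b)) (pt (suc (suc a)) b)

straight-middle : ∀ {p q r z} → Straight p q r → LatticeAdj p z → LatticeAdj z r → z ≡ q
straight-middle along₁  inc₁   inc₁   = refl
straight-middle along₂  inc₂   inc₂   = refl
straight-middle along₁₂ move₂₁ move₂₁ = refl

straight-ends-nonadj : ∀ {p q r} → Straight p q r → ¬ LatticeAdj p r
straight-ends-nonadj along₁  ()
straight-ends-nonadj along₂  ()
straight-ends-nonadj along₁₂ ()

straight-ends-≢ : ∀ {p q r} → Straight p q r → p ≢ r
straight-ends-≢ along₁  ()
straight-ends-≢ along₂  ()
straight-ends-≢ along₁₂ ()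

straight-middle-≢ˡ : ∀ {p q r} → Straight p q r → q ≢ p
straight-middle-≢ˡ along₁  ()
straight-middle-≢ˡ along₂  ()
straight-middle-≢ˡ along₁₂ ()

straight-middle-≢ʳ : ∀ {p q r} → Straight p q r → q ≢ r
straight-middle-≢ʳ along₁  ()
straight-middle-≢ʳ along₂  ()
straight-middle-≢ʳ along₁₂ ()

corner : ℕ → Pos → Point
corner k top   = pt 0 0
corner k left  = pt k 0
corner k right = pt 0 k

shift : Pos → ℕ → Point → Point
shift top   k p        = p
shift left  k (pt a b) = pt (a + k) b
shift right k (pt a b) = pt a (b + k)

shift-corner : ∀ e {k} → shift e k (corner k e) ≡ corner (k + k) e
shift-corner top   = refl
shift-corner left  = refl
shift-corner right = refl

shift-injective : ∀ c {k p q} → shift c k p ≡ shift c k q → p ≡ q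
shift-injective top eq = eq
shift-injective left {k} {pt a b} {pt c d} eq
  with refl ← +-cancelʳ-≡ k a c (cong (λ { (pt x _) → x }) eq) | refl ← eq = refl
shift-injective right {k} {pt a b} {pt c d} eq
  with refl ← +-cancelʳ-≡ k b d (cong (λ { (pt _ y) → y }) eq) | refl ← eq = refl

shift-adj : ∀ c k {p q} → LatticeAdj p q → LatticeAdj (shift c k p) (shift c k q)
shift-adj top   k e      = e
shift-adj left  k inc₁   = inc₁
shift-adj left  k dec₁   = dec₁
shift-adj left  k inc₂   = inc₂
shift-adj left  k dec₂   = dec₂
shift-adj left  k move₁₂ = move₁₂
shift-adj left  k move₂₁ = move₂₁
shift-adj right k inc₁   = inc₁
shift-adj right k dec₁   = dec₁
shift-adj right k inc₂   = inc₂
shift-adj right k dec₂   = dec₂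
shift-adj right k move₁₂ = move₁₂
shift-adj right k move₂₁ = move₂₁

shift-straight : ∀ c k {p q r} → Straight p q r → Straight (shift c k p) (shift c k q) (shift c k r)
shift-straight top   k s       = s
shift-straight left  k along₁  = along₁
shift-straight left  k along₂  = along₂
shift-straight left  k along₁₂ = along₁₂
shift-straight right k along₁  = along₁
shift-straight right k along₂  = along₂
shift-straight right k along₁₂ = along₁₂

shift-identity : ∀ c p → shift c 0 p ≡ p
shift-identity top   p        = refl
shift-identity left  (pt a b) = cong (λ x → pt x b) (+-identityʳ a)
shift-identity right (pt a b) = cong (pt a) (+-identityʳ b)

shift-shift : ∀ c {j k} p → shift c k (shift c j p) ≡ shift c (j + k) p
shift-shift top   p                = refl
shift-shift left  {j} {k} (pt a b) = cong (λ x → pt x b) (+-assoc a j k)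
shift-shift right {j} {k} (pt a b) = cong (pt a) (+-assoc b j k)

sum-shift : ∀ c k p → c ≢ top → sum (shift c k p) ≡ sum p + k
sum-shift top   k p        c≢top = contradiction refl c≢top
sum-shift left  k (pt a b) _     = xy∙z≈xz∙y a k b
sum-shift right k (pt a b) _     = sym (+-assoc a b k)

sum-shift≤ : ∀ c k p → sum (shift c k p) ≤ sum p + k
sum-shift≤ top   k p = m≤m+n (sum p) k
sum-shift≤ left  k p = ≤-reflexive (sum-shift left k p λ ())
sum-shift≤ right k p = ≤-reflexive (sum-shift right k p λ ())

sum≡0⇒origin : ∀ p → sum p ≡ 0 → p ≡ pt 0 0
sum≡0⇒origin (pt a b) eq with refl ← m+n≡0⇒m≡0 a eq | refl ← m+n≡0⇒n≡0 a eq = refl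

shift-within⇒origin : ∀ c k p → c ≢ top → sum (shift c k p) ≤ k → p ≡ pt 0 0
shift-within⇒origin c k p c≢top within =
  sum≡0⇒origin p (n≤0⇒n≡0 (+-cancelʳ-≤ k (sum p) 0 (subst (_≤ k) (sum-shift c k p c≢top) within)))

shift-meet : ∀ {c d k p q} → c ≢ d → sum p ≤ k → sum q ≤ k →
             shift c k p ≡ shift d k q → p ≡ corner k d × q ≡ corner k c
shift-meet {top}   {top}   c≢d _ _ _ = contradiction refl c≢d
shift-meet {left}  {left}  c≢d _ _ _ = contradiction refl c≢d
shift-meet {right} {right} c≢d _ _ _ = contradiction refl c≢d
shift-meet {top} {left} {k} {q = q} _ p≤k _ refl
  with refl ← shift-within⇒origin left k q (λ ()) p≤k = refl , refl
shift-meet {left} {top} {k} {p} _ _ q≤k refl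
  with refl ← shift-within⇒origin left k p (λ ()) q≤k = refl , refl
shift-meet {top} {right} {k} {q = q} _ p≤k _ refl
  with refl ← shift-within⇒origin right k q (λ ()) p≤k = refl , refl
shift-meet {right} {top} {k} {p} _ _ q≤k refl
  with refl ← shift-within⇒origin right k p (λ ()) q≤k = refl , refl
-- Unifying the coordinates makes p = shift right k (pt a d) and q = shift left k (pt a d).
shift-meet {left} {right} {k} {pt a _} {pt _ d} _ p≤k _ refl
  with refl ← shift-within⇒origin right k (pt a d) (λ ()) p≤k = refl , refl
shift-meet {right} {left} {k} {pt _ d} {pt a _} _ _ q≤k refl
  with refl ← shift-within⇒origin right k (pt a d) (λ ()) q≤k = refl , refl

-- Lattice positions of the vertices of ST_3^n

-- ST_3^n has side length side n = 2^n; span n = 2^n − 1 avoids truncated subtraction.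
span side : ℕ → ℕ
span zero    = 0
span (suc n) = span n + side n
side n = suc (span n)

pos : ∀ n → V n → Point
pos zero    e       = corner 1 e
pos (suc n) (c , x) = shift c (side n) (pos n x)

pos-ext : ∀ n e → pos n (ext n e) ≡ corner (side n) e
pos-ext zero    e = refl
pos-ext (suc n) e = trans (cong (shift e (side n)) (pos-ext n e)) (shift-corner e)

sum-pos≤side : ∀ n x → sum (pos n x) ≤ side n
sum-pos≤side zero    top     = z≤n
sum-pos≤side zero    left    = s≤s z≤n
sum-pos≤side zero    right   = s≤s z≤n
sum-pos≤side (suc n) (c , x) =
  ≤-trans (sum-shift≤ c (side n) (pos n x)) (+-monoˡ-≤ (side n) (sum-pos≤side n x))

rawEdge⇒latticeAdj : ∀ {n x y} → RawEdge n x y → LatticeAdj (pos n x) (pos n y)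
rawEdge⇒latticeAdj (k3 {top}   {top}   x≢y) = contradiction refl x≢y
rawEdge⇒latticeAdj (k3 {top}   {left}  _)   = inc₁
rawEdge⇒latticeAdj (k3 {top}   {right} _)   = inc₂
rawEdge⇒latticeAdj (k3 {left}  {top}   _)   = dec₁
rawEdge⇒latticeAdj (k3 {left}  {left}  x≢y) = contradiction refl x≢y
rawEdge⇒latticeAdj (k3 {left}  {right} _)   = move₁₂
rawEdge⇒latticeAdj (k3 {right} {top}   _)   = dec₂
rawEdge⇒latticeAdj (k3 {right} {left}  _)   = move₂₁
rawEdge⇒latticeAdj (k3 {right} {right} x≢y) = contradiction refl x≢y
rawEdge⇒latticeAdj {suc n} (copy c e) = shift-adj c (side n) (rawEdge⇒latticeAdj e)

glue⇒pos≡ : ∀ {n x y} → Glue n x y → pos n x ≡ pos n y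
glue⇒pos≡ {suc n} (inside c g) = cong (shift c (side n)) (glue⇒pos≡ g)
glue⇒pos≡ {suc n} glueTL rewrite pos-ext n left  | pos-ext n top  = refl
glue⇒pos≡ {suc n} glueTR rewrite pos-ext n right | pos-ext n top  = refl
glue⇒pos≡ {suc n} glueLR rewrite pos-ext n right | pos-ext n left = refl

pos-resp-Same : ∀ {n x y} → Same n x y → pos n x ≡ pos n y
pos-resp-Same {n} = EqClosure.gfold isEquivalence (pos n) glue⇒pos≡

Same-sym : ∀ {n x y} → Same n x y → Same n y x
Same-sym {n} = EqClosure.symmetric (Glue n)

Same-lift : ∀ {n} c {x y} → Same n x y → Same (suc n) (c , x) (c , y)
Same-lift c = EqClosure.gmap (c ,_) (inside c)

junction : ∀ {n c d} → c ≢ d → Same (suc n) (c , ext n d) (d , ext n c)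
junction {c = top}   {top}   c≢d = contradiction refl c≢d
junction {c = top}   {left}  _   = fwd glueTL ◅ ε
junction {c = top}   {right} _   = fwd glueTR ◅ ε
junction {c = left}  {top}   _   = bwd glueTL ◅ ε
junction {c = left}  {left}  c≢d = contradiction refl c≢d
junction {c = left}  {right} _   = fwd glueLR ◅ ε
junction {c = right} {top}   _   = bwd glueTR ◅ ε
junction {c = right} {left}  _   = bwd glueLR ◅ ε
junction {c = right} {right} c≢d = contradiction refl c≢d

pos-injective : ∀ n {x y} → pos n x ≡ pos n y → Same n x y
pos-injective zero {top}   {top}   _  = ε
pos-injective zero {top}   {left}  ()
pos-injective zero {top}   {right} ()
pos-injective zero {left}  {top}   ()
pos-injective zero {left}  {left}  _  = ε
pos-injective zero {left}  {right} ()
pos-injective zero {right} {top}   ()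
pos-injective zero {right} {left}  ()
pos-injective zero {right} {right} _  = ε
pos-injective (suc n) {c , x} {d , y} eq with c ≟ d
... | yes refl = Same-lift c (pos-injective n (shift-injective c eq))
... | no c≢d
  with x≡ , y≡ ← shift-meet c≢d (sum-pos≤side n x) (sum-pos≤side n y) eq
  = Same-lift c (at-corner x≡) ◅◅ junction c≢d ◅◅ Same-sym (Same-lift d (at-corner y≡))
  where
  at-corner : ∀ {z e} → pos n z ≡ corner (side n) e → Same n z (ext n e)
  at-corner {e = e} z≡ = pos-injective n (trans z≡ (sym (pos-ext n e)))

rawEdge-sym : ∀ {n x y} → RawEdge n x y → RawEdge n y x
rawEdge-sym (k3 x≢y)   = k3 (≢-sym x≢y)
rawEdge-sym (copy c e) = copy c (rawEdge-sym e)

rawEdge⇒adj : ∀ {n x y} → RawEdge n x y → Adj n x y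
rawEdge⇒adj e = _ , _ , ε , e , ε

adj-sym : ∀ {n x y} → Adj n x y → Adj n y x
adj-sym (x′ , y′ , x~x′ , e , y′~y) = y′ , x′ , Same-sym y′~y , rawEdge-sym e , Same-sym x~x′

adj-respˡ-Same : ∀ {n x x′ y} → Same n x x′ → Adj n x′ y → Adj n x y
adj-respˡ-Same x~x′ (a , b , x′~a , e , b~y) = a , b , x~x′ ◅◅ x′~a , e , b~y

adj-lift : ∀ {n} c {x y} → Adj n x y → Adj (suc n) (c , x) (c , y)
adj-lift c (a , b , x~a , e , b~y) = (c , a) , (c , b) , Same-lift c x~a , copy c e , Same-lift c b~y

adj⇒latticeAdj : ∀ {n x y} → Adj n x y → LatticeAdj (pos n x) (pos n y)
adj⇒latticeAdj (_ , _ , x~x′ , e , y′~y) =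
  subst₂ LatticeAdj (sym (pos-resp-Same x~x′)) (pos-resp-Same y′~y) (rawEdge⇒latticeAdj e)

-- The neighbour of the extreme vertex e in the direction of the extreme vertex f.
nextTo : ∀ n → Pos → Pos → V n
nextTo zero    e f = f
nextTo (suc n) e f = e , nextTo n e f

ext-edge-nextTo : ∀ n {e f} → e ≢ f → RawEdge n (ext n e) (nextTo n e f)
ext-edge-nextTo zero    e≢f = k3 e≢f
ext-edge-nextTo (suc n) e≢f = copy _ (ext-edge-nextTo n e≢f)

pos-nextTo : ∀ n e f → pos n (nextTo n e f) ≡ shift e (span n) (corner 1 f)
pos-nextTo zero    e f = sym (shift-identity e (corner 1 f))
pos-nextTo (suc n) e f = begin
  shift e (side n) (pos n (nextTo n e f))                ≡⟨ cong (shift e (side n)) (pos-nextTo n e f) ⟩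
  shift e (side n) (shift e (span n) (corner 1 f))       ≡⟨ shift-shift e (corner 1 f) ⟩
  shift e (span n + side n) (corner 1 f)                 ∎
  where open ≡-Reasoning

-- Vertices straddled by two neighbours on a lattice line

record Straddled (n : ℕ) (u : V n) : Set where
  field
    before after : V n
    before-adj   : Adj n u before
    after-adj    : Adj n u after
    straight     : Straight (pos n before) (pos n u) (pos n after)

Straddled-resp : ∀ {n u u′} → Same n u u′ → Straddled n u → Straddled n u′
Straddled-resp u~u′ s = record
  { before     = before
  ; after      = after
  ; before-adj = adj-respˡ-Same (Same-sym u~u′) before-adj
  ; after-adj  = adj-respˡ-Same (Same-sym u~u′) after-adj
  ; straight   = subst (λ q → Straight _ q _) (pos-resp-Same u~u′) straight
  }
  where open Straddled s

Straddled-lift : ∀ {n u} c → Straddled n u → Straddled (suc n) (c , u)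
Straddled-lift {n} c s = record
  { before     = c , before
  ; after      = c , after
  ; before-adj = adj-lift c before-adj
  ; after-adj  = adj-lift c after-adj
  ; straight   = shift-straight c (side n) straight
  }
  where open Straddled s

-- The junction of copies c and d is straddled by the neighbours of the shared
-- extreme vertex inside c and inside d.
junction-straddle : ∀ n {c d} → c ≢ d →
  Straight (shift c (side n) (shift d (span n) (corner 1 c)))
           (shift c (side n) (corner (side n) d))
           (shift d (side n) (shift c (span n) (corner 1 d))) →
  Straddled (suc n) (c , ext n d)
junction-straddle n {c} {d} c≢d line = record
  { before     = c , nextTo n d c
  ; after      = d , nextTo n c d
  ; before-adj = rawEdge⇒adj (copy c (ext-edge-nextTo n (≢-sym c≢d)))
  ; after-adj  = adj-respˡ-Same (junction c≢d) (rawEdge⇒adj (copy d (ext-edge-nextTo n c≢d)))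
  ; straight   = line′
  }
  where
  line′ : Straight (pos (suc n) (c , nextTo n d c)) (pos (suc n) (c , ext n d)) (pos (suc n) (d , nextTo n c d))
  line′ rewrite pos-nextTo n d c | pos-ext n d | pos-nextTo n c d = line

straddled-junction : ∀ n {c d} → c ≢ d → Straddled (suc n) (c , ext n d)
straddled-junction n {top}   {left}  c≢d = junction-straddle n c≢d along₁
straddled-junction n {top}   {right} c≢d = junction-straddle n c≢d along₂
straddled-junction n {right} {left}  c≢d = junction-straddle n c≢d along₁₂
straddled-junction n {left}  {top}   _   = Straddled-resp (junction λ ()) (junction-straddle n (λ ()) along₁)
straddled-junction n {right} {top}   _   = Straddled-resp (junction λ ()) (junction-straddle n (λ ()) along₂)
straddled-junction n {left}  {right} _   = Straddled-resp (junction λ ()) (junction-straddle n (λ ()) along₁₂)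
straddled-junction n {top}   {top}   c≢d = contradiction refl c≢d
straddled-junction n {left}  {left}  c≢d = contradiction refl c≢d
straddled-junction n {right} {right} c≢d = contradiction refl c≢d

extreme-or-straddled : ∀ n u → IsExtreme n u ⊎ Straddled n u
extreme-or-straddled zero    u       = inj₁ (u , ε)
extreme-or-straddled (suc n) (c , u) with extreme-or-straddled n u
... | inj₂ s = inj₂ (Straddled-lift c s)
... | inj₁ (e , u~e) with c ≟ e
...   | yes refl = inj₁ (c , Same-lift c u~e)
...   | no c≢e   = inj₂ (Straddled-resp (Same-sym (Same-lift c u~e)) (straddled-junction n c≢e))

walk-length≥2 : ∀ {n x y} → pos n x ≢ pos n y → ¬ LatticeAdj (pos n x) (pos n y) →
                (p : Walk n x y) → 2 ≤ length p
walk-length≥2 x≢y _ (stop x~y) = contradiction (pos-resp-Same x~y) x≢y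
walk-length≥2 _ nonadj (step a (stop z~y)) =
  contradiction (subst (LatticeAdj _) (pos-resp-Same z~y) (adj⇒latticeAdj a)) nonadj
walk-length≥2 _ _ (step _ (step _ _)) = s≤s (s≤s z≤n)

module _ {n u} (s : Straddled n u) where
  open Straddled s

  geodesic : Walk n before after
  geodesic = step (adj-sym before-adj) (step after-adj (stop ε))

  geodesic-shortest : IsShortest geodesic
  geodesic-shortest = walk-length≥2 (straight-ends-≢ straight) (straight-ends-nonadj straight)

  on-shortest : ∀ {x} (p : Walk n before after) → IsShortest p → OnWalk n x p →
                Same n x before ⊎ Same n x after ⊎ Same n x u
  on-shortest p@(stop _)          _ _ with () ← geodesic-shortest p
  on-shortest p@(step _ (stop _)) _ _ with s≤s () ← geodesic-shortest p
  on-shortest (step _ (step _ (step _ _))) shortest _ with s≤s (s≤s ()) ← shortest geodesic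
  on-shortest (step {y = m} a₁ (step a₂ (stop w~after))) _ on = on-two-step on
    where
    middle~u : Same n m u
    middle~u = pos-injective n (straight-middle straight (adj⇒latticeAdj a₁)
                 (subst (LatticeAdj _) (pos-resp-Same w~after) (adj⇒latticeAdj a₂)))
    on-two-step : ∀ {x} → OnWalk n x (step a₁ (step a₂ (stop w~after))) →
                  Same n x before ⊎ Same n x after ⊎ Same n x u
    on-two-step (here x~before)                 = inj₁ x~before
    on-two-step (there (here x~middle))         = inj₂ (inj₂ (x~middle ◅◅ middle~u))
    on-two-step (there (there (here x~w)))      = inj₂ (inj₁ (x~w ◅◅ w~after))

  on-geodesic : ∀ {x} → Same n x before ⊎ Same n x after ⊎ Same n x u → InInterval n before after x
  on-geodesic (inj₁ x~before)        = geodesic , geodesic-shortest , here x~before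
  on-geodesic (inj₂ (inj₁ x~after))  = geodesic , geodesic-shortest , there (there (here x~after))
  on-geodesic (inj₂ (inj₂ x~u))      = geodesic , geodesic-shortest , there (here x~u)

  straddled-interval : ∀ x → InInterval n before after x ⇔ (Same n x before ⊎ Same n x after ⊎ Same n x u)
  straddled-interval x = mk⇔ (λ (p , shortest , on) → on-shortest p shortest on) on-geodesic

claim1 : (n : ℕ) → 1 ≤ n → (u : V n) → ¬ IsExtreme n u →
    ∃[ v ] ∃[ w ] (¬ Same n u v × ¬ Same n u w ×
      ((x : V n) → InInterval n v w x ⇔ (Same n x v ⊎ Same n x w ⊎ Same n x u)))
claim1 n _ u non-extreme with extreme-or-straddled n u
... | inj₁ extreme = contradiction extreme non-extreme
... | inj₂ s =
  before , after ,
  (λ u~v → straight-middle-≢ˡ straight (pos-resp-Same u~v)) ,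
  (λ u~w → straight-middle-≢ʳ straight (pos-resp-Same u~w)) ,
  straddled-interval s
  where open Straddled s
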